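{- Let $G$ be a finite simple graph with $\delta(G)\ge1$ and let $m\ge1$. Then $str(G+mK_1)=str(G)$.
   Context: $G+mK_1$ is the disjoint union of $G$ with $m$ isolated vertices. For a graph $G$ of order $p$ with at least one edge, a numbering is a bijection $f:V(G)\to\{1,\dots,p\}$; $str_f(G)=\max\{f(u)+f(v): uv\in E(G)\}$ and $str(G)=\min\{str_f(G)\}$ over numberings. $\delta$ is minimum degree. -}

module Defs where

open import Data.Nat using (ℕ; suc; _+_; _⊔_; _≤_)
open import Data.Fin using (Fin; toℕ; splitAt)
open import Data.Bool using (Bool; true; false; if_then_else_)
open import Data.Sum using (inj₁; inj₂)
open import Data.List using (List; foldr; map; concatMap; allFin)
open import Data.Product using (Σ; _×_; _,_)
open import Function.Bundles using (_⤖_; Bijection)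
open import Relation.Binary.PropositionalEquality using (_≡_)

record Graph (p : ℕ) : Set where
  field
    adj   : Fin p → Fin p → Bool
    sym   : ∀ u v → adj u v ≡ adj v u
    irrefl : ∀ u → adj u u ≡ false
open Graph public

MinDegree≥1 : ∀ {p} → Graph p → Set
MinDegree≥1 {p} G = ∀ (u : Fin p) → Σ (Fin p) λ v → adj G u v ≡ true

-- G + m K₁ : G together with m new isolated vertices (indices p .. p+m-1)
addIsolated : ∀ {p} → Graph p → (m : ℕ) → Graph (p + m)
addIsolated {p} G m = record
  { adj = a
  ; sym = s
  ; irrefl = r
  }
  where
  a : Fin (p + m) → Fin (p + m) → Bool
  a x y with splitAt p x | splitAt p y
  ... | inj₁ u | inj₁ v = adj G u v
  ... | inj₁ _ | inj₂ _ = false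
  ... | inj₂ _ | inj₁ _ = false
  ... | inj₂ _ | inj₂ _ = false
  s : ∀ x y → a x y ≡ a y x
  s x y with splitAt p x | splitAt p y
  ... | inj₁ u | inj₁ v = sym G u v
  ... | inj₁ _ | inj₂ _ = Relation.Binary.PropositionalEquality.refl
  ... | inj₂ _ | inj₁ _ = Relation.Binary.PropositionalEquality.refl
  ... | inj₂ _ | inj₂ _ = Relation.Binary.PropositionalEquality.refl
  r : ∀ x → a x x ≡ false
  r x with splitAt p x
  ... | inj₁ u = irrefl G u
  ... | inj₂ _ = Relation.Binary.PropositionalEquality.refl

-- A numbering is a bijection V(G) → {1,…,p}; we represent {1,…,p} by Fin p
-- via i ↦ toℕ i + 1.
Numbering : ℕ → Set
Numbering p = Fin p ⤖ Fin p

label : ∀ {p} → Numbering p → Fin p → ℕ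
label f v = suc (toℕ (Bijection.to f v))

-- str_f(G) = max { f(u) + f(v) : uv ∈ E(G) }   (0 if G has no edges)
strf : ∀ {p} → Graph p → Numbering p → ℕ
strf {p} G f =
  foldr _⊔_ 0
    (concatMap (λ u → map (λ v → if adj G u v then label f u + label f v else 0)
                          (allFin p))
               (allFin p))

IsStr : ∀ {p} → Graph p → ℕ → Set
IsStr {p} G s =
  (Σ (Numbering p) λ f → strf G f ≡ s) × (∀ (f : Numbering p) → s ≤ strf G f)

-- Isolated vertices carry no edges, so giving them the labels p+1, …, p+m turns a
-- numbering of G into one of G + mK₁ with the same strength.  Conversely, a
-- numbering of G + mK₁ restricted to V(G) is an injection into {1, …, p+m}, and any
-- such injection can be compressed into a numbering of G whose labels are pointwise
-- no larger; since str_f only grows with the labels, str(G) ≤ str(G + mK₁).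
module Submission where

open import Defs hiding (sym)
open import Data.Bool using (true; false; if_then_else_)
open import Data.Fin using (Fin; zero; suc; toℕ; fromℕ; lower₁; punchIn; punchOut; splitAt; _↑ˡ_; _≟_)
open import Data.Fin.Permutation using (Permutation′; insert; _⟨$⟩ʳ_)
import Data.Fin.Permutation as Permutation
open import Data.Fin.Properties
  using (toℕ-fromℕ; toℕ-injective; toℕ-lower₁; lower₁-injective; punchInᵢ≢i; punchIn-injective;
         punchIn-punchOut; injective⇒≤; any?; toℕ-↑ˡ; ↑ˡ-injective; splitAt-↑ˡ; splitAt⁻¹-↑ˡ; +↔⊎)
open import Data.List using (foldr; map; concatMap; allFin)
open import Data.List.Properties using (foldr-preservesᵇ; foldr-preservesᵒ)
import Data.List.Relation.Unary.All.Properties as All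
import Data.List.Relation.Unary.Any as Any
open import Data.List.Membership.Propositional.Properties using (∈-concatMap⁺; ∈-map⁺; ∈-allFin)
open import Data.Nat using (ℕ; zero; suc; _+_; _⊔_; _≤_; _≥_; z≤n; s≤s)
open import Data.Nat.Properties using (⊔-lub; m≤m⊔n; m≤n⊔m; ≤-trans; ≤-reflexive; ≤-antisym; +-mono-≤)
open import Data.Product using (Σ; _×_; _,_; proj₁; proj₂)
open import Data.Sum using (_⊎_; inj₁; inj₂)
open import Data.Sum.Function.Propositional using (_⊎-↔_)
open import Function.Bundles using (Bijection)
open import Function.Construct.Composition using (_↔-∘_)
open import Function.Construct.Identity using (↔-id)
open import Function.Construct.Symmetry using (↔-sym)
open import Function.Definitions using (Injective)
open import Function.Properties.Bijection using (⤖⇒↔)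
open import Function.Properties.Inverse using (↔⇒⤖)
open import Relation.Binary.PropositionalEquality using (_≡_; _≢_; refl; sym; trans; cong; subst; subst₂)
open import Relation.Nullary using (yes; no)

maxOverPairs : ∀ {p} → (Fin p → Fin p → ℕ) → ℕ
maxOverPairs {p} h = foldr _⊔_ 0 (concatMap (λ u → map (h u) (allFin p)) (allFin p))

≤-maxOverPairs : ∀ {p} (h : Fin p → Fin p → ℕ) u v → h u v ≤ maxOverPairs h
≤-maxOverPairs {p} h u v = foldr-preservesᵒ ≤-⊔ 0 _ (inj₂ (Any.map ≤-reflexive h[u,v]∈))
  where
  ≤-⊔ : ∀ x y → h u v ≤ x ⊎ h u v ≤ y → h u v ≤ x ⊔ y
  ≤-⊔ x y (inj₁ ≤x) = ≤-trans ≤x (m≤m⊔n x y)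
  ≤-⊔ x y (inj₂ ≤y) = ≤-trans ≤y (m≤n⊔m x y)
  h[u,v]∈ = ∈-concatMap⁺ (λ u → map (h u) (allFin p))
              (Any.map (λ { refl → ∈-map⁺ (h u) (∈-allFin v) }) (∈-allFin u))

maxOverPairs-lub : ∀ {p} (h : Fin p → Fin p → ℕ) k → (∀ u v → h u v ≤ k) → maxOverPairs h ≤ k
maxOverPairs-lub h k h≤k = foldr-preservesᵇ {P = _≤ k} ⊔-lub z≤n
  (All.concat⁺ (All.map⁺ (All.tabulate⁺ λ u → All.map⁺ (All.tabulate⁺ λ v → h≤k u v))))

label+label≤strf : ∀ {p} (G : Graph p) f u v → adj G u v ≡ true → label f u + label f v ≤ strf G f
label+label≤strf G f u v uv = subst (_≤ strf G f)
  (cong (λ b → if b then label f u + label f v else 0) uv)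
  (≤-maxOverPairs (λ u v → if adj G u v then label f u + label f v else 0) u v)

strf-lub : ∀ {p} (G : Graph p) f k →
           (∀ u v → adj G u v ≡ true → label f u + label f v ≤ k) → strf G f ≤ k
strf-lub G f k edge≤k = maxOverPairs-lub _ k λ u v → edgeTerm≤k u v (adj G u v) refl
  where
  edgeTerm≤k : ∀ u v b → adj G u v ≡ b → (if b then label f u + label f v else 0) ≤ k
  edgeTerm≤k u v true  uv = edge≤k u v uv
  edgeTerm≤k u v false _  = z≤n

strf-mono : ∀ {p q} (G : Graph p) (H : Graph q) f g (ι : Fin p → Fin q) →
            (∀ u v → adj G u v ≡ true → adj H (ι u) (ι v) ≡ true) →
            (∀ u → label f u ≤ label g (ι u)) → strf G f ≤ strf H g
strf-mono G H f g ι hom dom = strf-lub G f _ λ u v uv →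
  ≤-trans (+-mono-≤ (dom u) (dom v)) (label+label≤strf H g (ι u) (ι v) (hom u v uv))

IsStr-transfer : ∀ {p q} (G : Graph p) (H : Graph q)
                 (extend : Numbering p → Numbering q) (compress : Numbering q → Numbering p) →
                 (∀ f → strf H (extend f) ≡ strf G f) → (∀ g → strf G (compress g) ≤ strf H g) →
                 ∀ s → (IsStr G s → IsStr H s) × (IsStr H s → IsStr G s)
IsStr-transfer G H extend compress strf-extend strf-compress s = strG⇒strH , strH⇒strG
  where
  strG⇒strH : IsStr G s → IsStr H s
  strG⇒strH ((f , f≡s) , s≤G) =
    (extend f , trans (strf-extend f) f≡s) , λ g → ≤-trans (s≤G (compress g)) (strf-compress g)
  strH⇒strG : IsStr H s → IsStr G s
  strH⇒strG ((g , g≡s) , s≤H) =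
    (compress g , ≤-antisym (subst (strf G (compress g) ≤_) g≡s (strf-compress g)) (s≤G (compress g))) , s≤G
    where
    s≤G : ∀ f → s ≤ strf G f
    s≤G f = subst (s ≤_) (strf-extend f) (s≤H (extend f))

toℕ-punchIn-fromℕ : ∀ n (i : Fin n) → toℕ (punchIn (fromℕ n) i) ≡ toℕ i
toℕ-punchIn-fromℕ (suc n) zero    = refl
toℕ-punchIn-fromℕ (suc n) (suc i) = cong suc (toℕ-punchIn-fromℕ n i)

≢fromℕ⇒≢toℕ : ∀ {n} {i : Fin (suc n)} → i ≢ fromℕ n → n ≢ toℕ i
≢fromℕ⇒≢toℕ {n} i≢n n≡i = i≢n (toℕ-injective (trans (sym n≡i) (sym (toℕ-fromℕ n))))

-- Recursion on n: if the largest value n is attained at v₀, send v₀ to the largest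
-- value p of Fin (suc p) and compress the rest; otherwise lower every value.
injective⇒permutation-below : ∀ {n p} (h : Fin p → Fin n) → Injective _≡_ _≡_ h →
                              Σ (Permutation′ p) λ π → ∀ v → toℕ (π ⟨$⟩ʳ v) ≤ toℕ (h v)
injective⇒permutation-below {zero} {zero}  h _ = Permutation.id , λ ()
injective⇒permutation-below {zero} {suc p} h _ with h zero
... | ()
injective⇒permutation-below {suc n} {p} h h-inj with any? (λ v → h v ≟ fromℕ n)
... | no n∉img = π , π≤h
  where
  h′ : Fin p → Fin n
  h′ v = lower₁ (h v) (≢fromℕ⇒≢toℕ (λ hv≡n → n∉img (v , hv≡n)))
  rec = injective⇒permutation-below h′ (λ eq → h-inj (lower₁-injective eq))
  π = proj₁ rec
  π≤h : ∀ v → toℕ (π ⟨$⟩ʳ v) ≤ toℕ (h v)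
  π≤h v = subst (toℕ (π ⟨$⟩ʳ v) ≤_) (toℕ-lower₁ (h v) _) (proj₂ rec v)
injective⇒permutation-below {suc n} {zero}  h _ | yes (() , _)
injective⇒permutation-below {suc n} {suc p} h h-inj | yes (v₀ , hv₀≡n) = π , π≤h
  where
  h′ : Fin p → Fin n
  h′ w = lower₁ (h (punchIn v₀ w))
    (≢fromℕ⇒≢toℕ (λ eq → punchInᵢ≢i v₀ w (h-inj (trans eq (sym hv₀≡n)))))
  h′-inj : Injective _≡_ _≡_ h′
  h′-inj eq = punchIn-injective v₀ _ _ (h-inj (lower₁-injective eq))
  rec = injective⇒permutation-below h′ h′-inj
  π = insert v₀ (fromℕ p) (proj₁ rec)
  π≤h : ∀ v → toℕ (π ⟨$⟩ʳ v) ≤ toℕ (h v)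
  π≤h v with v₀ ≟ v
  ... | yes refl = subst₂ _≤_ (sym (toℕ-fromℕ p)) (trans (sym (toℕ-fromℕ n)) (cong toℕ (sym hv₀≡n)))
                     (injective⇒≤ h′-inj)
  ... | no v₀≢v = subst₂ _≤_ (sym (toℕ-punchIn-fromℕ p (proj₁ rec ⟨$⟩ʳ w)))
                    (trans (toℕ-lower₁ _ _) (cong (λ x → toℕ (h x)) (punchIn-punchOut v₀≢v)))
                    (proj₂ rec w)
    where w = punchOut v₀≢v

module _ {p : ℕ} (G : Graph p) (m : ℕ) where

  adj-addIsolated⁺ : ∀ u v → adj G u v ≡ true → adj (addIsolated G m) (u ↑ˡ m) (v ↑ˡ m) ≡ true
  adj-addIsolated⁺ u v rewrite splitAt-↑ˡ p u m | splitAt-↑ˡ p v m = λ uv → uv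

  adj-addIsolated⁻ : ∀ x y → adj (addIsolated G m) x y ≡ true →
                     Σ (Fin p) λ u → Σ (Fin p) λ v → u ↑ˡ m ≡ x × v ↑ˡ m ≡ y × adj G u v ≡ true
  adj-addIsolated⁻ x y with splitAt p x in x≡u | splitAt p y in y≡v
  ... | inj₁ u | inj₁ v = λ uv → u , v , splitAt⁻¹-↑ˡ x≡u , splitAt⁻¹-↑ˡ y≡v , uv
  ... | inj₁ _ | inj₂ _ = λ ()
  ... | inj₂ _ | inj₁ _ = λ ()
  ... | inj₂ _ | inj₂ _ = λ ()

  extendNumbering : Numbering p → Numbering (p + m)
  extendNumbering f = ↔⇒⤖ (↔-sym +↔⊎ ↔-∘ ((⤖⇒↔ f ⊎-↔ ↔-id (Fin m)) ↔-∘ +↔⊎))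

  label-extendNumbering : ∀ f u → label (extendNumbering f) (u ↑ˡ m) ≡ label f u
  label-extendNumbering f u rewrite splitAt-↑ˡ p u m = cong suc (toℕ-↑ˡ (Bijection.to f u) m)

  compressNumbering : Numbering (p + m) → Numbering p
  compressNumbering g = ↔⇒⤖ (proj₁ (injective⇒permutation-below h h-inj))
    where
    h : Fin p → Fin (p + m)
    h u = Bijection.to g (u ↑ˡ m)
    h-inj : Injective _≡_ _≡_ h
    h-inj eq = ↑ˡ-injective m _ _ (Bijection.injective g eq)

  label-compressNumbering : ∀ g u → label (compressNumbering g) u ≤ label g (u ↑ˡ m)
  label-compressNumbering g u = s≤s (proj₂ (injective⇒permutation-below _ _) u)

  strf-extendNumbering : ∀ f → strf (addIsolated G m) (extendNumbering f) ≡ strf G f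
  strf-extendNumbering f = ≤-antisym
    (strf-lub (addIsolated G m) (extendNumbering f) _ edge≤)
    (strf-mono G (addIsolated G m) f (extendNumbering f) (_↑ˡ m)
      adj-addIsolated⁺ (λ u → ≤-reflexive (sym (label-extendNumbering f u))))
    where
    edge≤ : ∀ x y → adj (addIsolated G m) x y ≡ true →
            label (extendNumbering f) x + label (extendNumbering f) y ≤ strf G f
    edge≤ x y xy with adj-addIsolated⁻ x y xy
    ... | u , v , refl , refl , uv =
      subst₂ (λ a b → a + b ≤ strf G f) (sym (label-extendNumbering f u)) (sym (label-extendNumbering f v))
        (label+label≤strf G f u v uv)

  strf-compressNumbering : ∀ g → strf G (compressNumbering g) ≤ strf (addIsolated G m) g
  strf-compressNumbering g = strf-mono G (addIsolated G m) (compressNumbering g) g (_↑ˡ m)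
    adj-addIsolated⁺ (label-compressNumbering g)

mainTheorem11 : ∀ {p : ℕ} (G : Graph p) → MinDegree≥1 G → (m : ℕ) → m ≥ 1 →
    ∀ (s : ℕ) → (IsStr G s → IsStr (addIsolated G m) s) × (IsStr (addIsolated G m) s → IsStr G s)
mainTheorem11 G _ m _ = IsStr-transfer G (addIsolated G m)
  (extendNumbering G m) (compressNumbering G m) (strf-extendNumbering G m) (strf-compressNumbering G m)
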